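{- Let $n\geq 2$ and $0\leq k\leq n/2$ be integers, and let $x_I=x_{i_1}x_{i_2}\cdots x_{i_k}$ be a squarefree monomial of degree $k$ in $x_1,\dots,x_n$. If the label $\mu(x_I)$ is a reverse lattice word, then $x_I$ is a linear combination of elements of $\mathcal{B}_{n,k}$ whose coefficients are nonnegative integer multiples of $1/2^k$.
   Context: The label $\mu(x_I)$ is the word of length $n$ over $\{1,2\}$ with $\mu(x_I)_j=2$ iff $x_j$ divides $x_I$; it is a reverse lattice word if every terminal segment contains at least as many 1s as 2s. $V_{n,k}$ is the $\mathbb{Q}$-vector space with basis the squarefree degree-$k$ monomials in $x_1,\dots,x_n$. Monomials are ordered lexicographically: for distinct $k$-subsets $I,J$ with $t=\min(I\,\Delta\,J)$, $x_I\prec x_J$ iff $t\in I$. A nonzero $v\in V_{n,k}$ is positive if the $\prec$-minimal monomial in $v$ has positive coefficient. A $k$-root is a product $\prod_{r=1}^k(\pm x_{i_{2r-1}}\pm x_{i_{2r}})$ with independent signs and $2k$ distinct indices; it is positive if positive in $V_{n,k}$. Each positive $k$-root can be written uniquely up to order of factors as $\prod_{r=1}^k(x_{i_{2r-1}}\pm x_{i_{2r}})$ with $i_{2r-1}<i_{2r}$ (normal form); factors $(x_i+x_j)$ are symmetric, indices not appearing are unused. A positive $k$-root has a defect if its normal form has, for some $i<j<r<s$: (i) factors $(x_i\pm x_r)$ and $(x_j\pm x_s)$; (ii) a factor $(x_i\pm x_s)$ and a symmetric factor $(x_j+x_r)$; (iii) a factor $(x_i\pm x_r)$ and an unused index $j$;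 or (iv) a symmetric factor $(x_i+x_j)$ and an unused index $r$. $\mathcal{B}_{n,k}$ is the set of positive $k$-roots with no defects (a basis of $V_{n,k}$). -}

module Defs where

open import Data.Nat as ℕ using (ℕ; zero; suc; _≤_; _^_)
open import Data.Nat.Properties using (m^n≢0)
open import Data.Integer as ℤ using (ℤ; +_)
open import Data.Rational as ℚ using (ℚ)
open import Data.Bool using (Bool; true; false; if_then_else_)
open import Data.Fin as Fin using (Fin)
open import Data.Fin.Subset using (Subset; _∈_; _∉_; ∣_∣)
open import Data.Vec as Vec using (Vec; lookup; replicate; zipWith; toList)
open import Data.Vec.Properties using (≡-dec)
open import Data.List as List using (List; []; _∷_; concatMap; foldr; length)
open import Data.List.Membership.Propositional as L using ()
open import Data.List.Relation.Unary.Unique.Propositional using (Unique)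
open import Data.Product using (Σ; _×_; _,_; ∃; ∃-syntax; proj₁; proj₂)
open import Data.Unit using (⊤)
open import Data.Empty using (⊥)
open import Data.Sum using (_⊎_)
open import Relation.Nullary using (¬_; yes; no)
open import Relation.Binary.PropositionalEquality using (_≡_)

-- Squarefree monomials x_I are encoded by subsets I ⊆ {1..n}
-- (index j ∈ Fin n stands for x_{j+1}; the order of Fin n is that of ℕ).

label : ∀ {n} → Subset n → Vec ℕ n
label I = Vec.map (λ b → if b then 2 else 1) I

count : ℕ → List ℕ → ℕ
count a []      = 0
count a (x ∷ w) with a ℕ.≟ x
... | yes _ = suc (count a w)
... | no  _ = count a w

ReverseLatticeWord : List ℕ → Set
ReverseLatticeWord []      = ⊤
ReverseLatticeWord (x ∷ w) = ReverseLatticeWord w × (count 2 (x ∷ w) ≤ count 1 (x ∷ w))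

Term : ℕ → Set
Term n = ℤ × Vec ℕ n

Poly : ℕ → Set
Poly n = List (Term n)

unitVec : ∀ {n} → Fin n → Vec ℕ n
unitVec {n} i = Vec.updateAt (replicate n 0) i (λ _ → 1)

polyOne : ∀ {n} → Poly n
polyOne {n} = (+ 1 , replicate n 0) ∷ []

polyMul : ∀ {n} → Poly n → Poly n → Poly n
polyMul P Q = concatMap (λ t → List.map (λ u → (proj₁ t ℤ.* proj₁ u , zipWith ℕ._+_ (proj₂ t) (proj₂ u))) Q) P

polyProd : ∀ {n} → List (Poly n) → Poly n
polyProd = foldr polyMul polyOne

coeff : ∀ {n} → Poly n → Vec ℕ n → ℤ
coeff []            e = + 0
coeff ((c , m) ∷ P) e with ≡-dec ℕ._≟_ m e
... | yes _ = c ℤ.+ coeff P e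
... | no  _ = coeff P e

monoExp : ∀ {n} → Subset n → Vec ℕ n
monoExp S = Vec.map (λ b → if b then 1 else 0) S

-- Positive k-roots in normal form: products of factors (x_a ± x_b), a < b.

record Factor (n : ℕ) : Set where
  constructor factor
  field
    fst  : Fin n
    snd  : Fin n
    lt   : fst Fin.< snd
    symm : Bool            -- true: (x_a + x_b) (symmetric); false: (x_a - x_b)
open Factor public

factorPoly : ∀ {n} → Factor n → Poly n
factorPoly f = (+ 1 , unitVec (fst f)) ∷ ((if symm f then + 1 else ℤ.- (+ 1)) , unitVec (snd f)) ∷ []

rootPoly : ∀ {n} → List (Factor n) → Poly n
rootPoly r = polyProd (List.map factorPoly r)

indices : ∀ {n} → List (Factor n) → List (Fin n)
indices = concatMap (λ f → fst f ∷ snd f ∷ [])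

IsNormalRoot : ∀ {n} → ℕ → List (Factor n) → Set
IsNormalRoot k r = length r ≡ k × Unique (indices r)

Unused : ∀ {n} → List (Factor n) → Fin n → Set
Unused r j = ¬ (j L.∈ indices r)

Defect : ∀ {n} → List (Factor n) → Set
Defect {n} r =
    (∃[ f ] ∃[ g ] (f L.∈ r) × (g L.∈ r) ×
       (fst f Fin.< fst g) × (fst g Fin.< snd f) × (snd f Fin.< snd g))
  ⊎
    (∃[ f ] ∃[ g ] (f L.∈ r) × (g L.∈ r) × (symm g ≡ true) ×
       (fst f Fin.< fst g) × (fst g Fin.< snd g) × (snd g Fin.< snd f))
  ⊎
    (∃[ f ] ∃[ j ] (f L.∈ r) × Unused r j × (fst f Fin.< j) × (j Fin.< snd f))
  ⊎
    (∃[ f ] ∃[ j ] (f L.∈ r) × (symm f ≡ true) × Unused r j × (snd f Fin.< j))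

InB : ∀ {n} → ℕ → List (Factor n) → Set
InB k r = IsNormalRoot k r × ¬ Defect r

ℤtoℚ : ℤ → ℚ
ℤtoℚ z = z ℚ./ 1

combCoeff : ∀ {n} → List (List (Factor n) × ℚ) → Subset n → ℚ
combCoeff []             S = ℚ.0ℚ
combCoeff ((b , c) ∷ L) S = c ℚ.* ℤtoℚ (coeff (rootPoly b) (monoExp S)) ℚ.+ combCoeff L S

monoCoeff : ∀ {n} → Subset n → Subset n → ℚ
monoCoeff {n} I S with ≡-dec Data.Bool._≟_ I S
... | yes _ = ℚ.1ℚ
... | no  _ = ℚ.0ℚ

IsMultOfInvPow2 : ℕ → ℚ → Set
IsMultOfInvPow2 k c = ∃[ m ] c ≡ ℚ._/_ (+ m) (2 ^ k) {{m^n≢0 2 k}}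

module Submission where

-- For k > 0 the last 2 of the reverse lattice word μ(x_I), at position p say, is
-- immediately followed by a 1, and deleting positions p, p+1 leaves the reverse lattice word of some
-- x_{I₀} of degree k − 1 in n − 2 variables; by induction 2^{k−1} x_{I₀} = Σ c_R R over R ∈ 𝓑_{n−2,k−1}.
-- No variable after x_p divides x_I, so x_I / x_p is x_{I₀} written in the variables other than
-- x_t, x_{t+1} for every t ≥ p, and the telescoping identity
--   2 x_p = 2(x_p − x_{p+1}) + … + 2(x_{n−2} − x_{n−1}) + (x_{n−1} − x_n) + (x_{n−1} + x_n)
-- expands 2^k x_I as a combination of products (x_t ± x_{t+1}) R. These have no defect: the new factor
-- encloses no index, and it is symmetric only when no index follows it.
-- Coefficients are compared on squarefree monomials only, where multiplying by x_a and adjoining the two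
-- new variables act on coefficient functions by substitutions.

open import Data.Bool as Bool using (Bool; true; false; if_then_else_; not; _∨_)
open import Data.Bool.Properties using (not-¬)
open import Data.Empty using (⊥; ⊥-elim)
open import Data.Fin as Fin using (Fin; zero; suc; toℕ)
import Data.Fin.Properties as Fin
open import Data.Fin.Subset using (Subset; ∣_∣) renaming (⊥ to ∅)
open import Data.Fin.Subset.Properties using (∣⊥∣≡0)
open import Data.Integer as ℤ using (ℤ; +_; 0ℤ; 1ℤ; -1ℤ)
import Data.Integer.Properties as ℤ
open import Data.Integer.Tactic.RingSolver using (solve-∀)
open import Data.List as List using (List; []; _∷_; _++_)
import Data.List.Properties as List
open import Data.List.Membership.Propositional using (_∈_)
open import Data.List.Membership.Propositional.Properties using (∈-map⁻; ∈-map⁺)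
open import Data.List.Relation.Unary.All as All using (All; _∷_)
import Data.List.Relation.Unary.All.Properties as All
open import Data.List.Relation.Unary.AllPairs using ([]; _∷_)
open import Data.List.Relation.Unary.Any using (here; there)
open import Data.List.Relation.Unary.Unique.Propositional using (Unique)
import Data.List.Relation.Unary.Unique.Propositional.Properties as Unique
open import Data.Nat as ℕ using (ℕ; zero; suc; _+_; _*_; _∸_; _^_; _≤_; _<_; z≤n; s≤s)
import Data.Nat.Properties as ℕ
open import Data.Product as Product using (_×_; _,_; ∃-syntax; proj₁; proj₂)
open import Data.Rational as ℚ using (ℚ)
import Data.Rational.Properties as ℚ
open import Data.Rational.Unnormalised as ℚᵘ using (mkℚᵘ; *≡*) renaming (_≃_ to _≃ᵘ_)
import Data.Rational.Unnormalised.Properties as ℚᵘ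
open import Data.Sum using (_⊎_; inj₁; inj₂)
open import Data.Unit using (⊤)
open import Data.Vec using (Vec; []; _∷_; lookup; replicate; zipWith; toList; _[_]≔_)
open import Data.Vec.Properties
  using (≡-dec; lookup∘update′; ∷-injective; ∷-injectiveˡ; ∷-injectiveʳ; map-id; map-replicate; zipWith-replicate₁)
open import Function using (_∘′_)
open import Relation.Binary.PropositionalEquality
open import Relation.Nullary using (yes; no)

open import Defs

private variable
  A : Set
  m n o : ℕ

-- Pairs of positions

-- insertPair t v a b puts a, b at positions t, t + 1 of v, or at its end if t ≥ length v.
insertPair : ℕ → Vec A m → A → A → Vec A (2 + m)
insertPair zero    v       a b = a ∷ b ∷ v
insertPair (suc t) []      a b = a ∷ b ∷ []
insertPair (suc t) (x ∷ v) a b = x ∷ insertPair t v a b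

removePair : ℕ → Vec A (2 + m) → Vec A m
removePair             zero    (x ∷ y ∷ v) = v
removePair {m = zero}  (suc t) (x ∷ y ∷ []) = []
removePair {m = suc m} (suc t) (x ∷ v)     = x ∷ removePair t v

pairFst : ℕ → (m : ℕ) → Fin (2 + m)
pairFst zero    m       = zero
pairFst (suc t) zero    = zero
pairFst (suc t) (suc m) = suc (pairFst t m)

pairSnd : ℕ → (m : ℕ) → Fin (2 + m)
pairSnd zero    m       = suc zero
pairSnd (suc t) zero    = suc zero
pairSnd (suc t) (suc m) = suc (pairSnd t m)

skipPair : ℕ → Fin m → Fin (2 + m)
skipPair zero    j       = suc (suc j)
skipPair (suc t) zero    = zero
skipPair (suc t) (suc j) = suc (skipPair t j)

lookup-insertPair-fst : ∀ t (v : Vec A m) a b → lookup (insertPair t v a b) (pairFst t m) ≡ a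
lookup-insertPair-fst zero    v       a b = refl
lookup-insertPair-fst (suc t) []      a b = refl
lookup-insertPair-fst (suc t) (x ∷ v) a b = lookup-insertPair-fst t v a b

lookup-insertPair-snd : ∀ t (v : Vec A m) a b → lookup (insertPair t v a b) (pairSnd t m) ≡ b
lookup-insertPair-snd zero    v       a b = refl
lookup-insertPair-snd (suc t) []      a b = refl
lookup-insertPair-snd (suc t) (x ∷ v) a b = lookup-insertPair-snd t v a b

removePair-insertPair : ∀ t (v : Vec A m) a b → removePair t (insertPair t v a b) ≡ v
removePair-insertPair zero    v       a b = refl
removePair-insertPair (suc t) []      a b = refl
removePair-insertPair (suc t) (x ∷ v) a b = cong (x ∷_) (removePair-insertPair t v a b)

insertPair-removePair : ∀ t (v : Vec A (2 + m)) →
  insertPair t (removePair t v) (lookup v (pairFst t m)) (lookup v (pairSnd t m)) ≡ v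
insertPair-removePair             zero    (x ∷ y ∷ v)  = refl
insertPair-removePair {m = zero}  (suc t) (x ∷ y ∷ []) = refl
insertPair-removePair {m = suc m} (suc t) (x ∷ v)      = cong (x ∷_) (insertPair-removePair t v)

lookup-removePair : ∀ t (v : Vec A (2 + m)) j → lookup (removePair t v) j ≡ lookup v (skipPair t j)
lookup-removePair             zero    (x ∷ y ∷ v) j       = refl
lookup-removePair {m = suc m} (suc t) (x ∷ v)     zero    = refl
lookup-removePair {m = suc m} (suc t) (x ∷ v)     (suc j) = lookup-removePair t v j

insertPair-injective : ∀ t {v w : Vec A m} {a b c d} →
  insertPair t v a b ≡ insertPair t w c d → v ≡ w × a ≡ c × b ≡ d
insertPair-injective t {v} {w} {a} {b} {c} {d} eq =
  trans (sym (removePair-insertPair t v a b)) (trans (cong (removePair t) eq) (removePair-insertPair t w c d)) ,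
  trans (sym (lookup-insertPair-fst t v a b)) (trans (cong (λ u → lookup u _) eq) (lookup-insertPair-fst t w c d)) ,
  trans (sym (lookup-insertPair-snd t v a b)) (trans (cong (λ u → lookup u _) eq) (lookup-insertPair-snd t w c d))

removePair-update : ∀ t j (v : Vec A (2 + m)) x →
  removePair t (v [ skipPair t j ]≔ x) ≡ removePair t v [ j ]≔ x
removePair-update             zero    j       (y ∷ z ∷ v) x = refl
removePair-update {m = suc m} (suc t) zero    (y ∷ v)     x = refl
removePair-update {m = suc m} (suc t) (suc j) (y ∷ v)     x = cong (y ∷_) (removePair-update t j v x)

update-insertPair-fst : ∀ t (v : Vec A m) a b x → insertPair t v a b [ pairFst t m ]≔ x ≡ insertPair t v x b
update-insertPair-fst zero    v       a b x = refl
update-insertPair-fst (suc t) []      a b x = refl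
update-insertPair-fst (suc t) (y ∷ v) a b x = cong (y ∷_) (update-insertPair-fst t v a b x)

skipPair≢pairFst : ∀ t (j : Fin m) → skipPair t j ≢ pairFst t m
skipPair≢pairFst zero                j       ()
skipPair≢pairFst {m = suc m} (suc t) zero    ()
skipPair≢pairFst {m = suc m} (suc t) (suc j) eq = skipPair≢pairFst t j (Fin.suc-injective eq)

skipPair≢pairSnd : ∀ t (j : Fin m) → skipPair t j ≢ pairSnd t m
skipPair≢pairSnd zero                j       ()
skipPair≢pairSnd {m = suc m} (suc t) zero    ()
skipPair≢pairSnd {m = suc m} (suc t) (suc j) eq = skipPair≢pairSnd t j (Fin.suc-injective eq)

toℕ-pairSnd : ∀ t m → toℕ (pairSnd t m) ≡ suc (toℕ (pairFst t m))
toℕ-pairSnd zero    m       = refl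
toℕ-pairSnd (suc t) zero    = refl
toℕ-pairSnd (suc t) (suc m) = cong suc (toℕ-pairSnd t m)

pairFst<pairSnd : ∀ t m → pairFst t m Fin.< pairSnd t m
pairFst<pairSnd t m = ℕ.≤-reflexive (sym (toℕ-pairSnd t m))

toℕ-pairSnd-last : ∀ t m → m ≤ t → toℕ (pairSnd t m) ≡ suc m
toℕ-pairSnd-last zero    zero    _         = refl
toℕ-pairSnd-last (suc t) zero    _         = refl
toℕ-pairSnd-last (suc t) (suc m) (s≤s m≤t) = cong suc (toℕ-pairSnd-last t m m≤t)

pairSnd≡pairFst-suc : ∀ t m → t < m → pairSnd t m ≡ pairFst (suc t) m
pairSnd≡pairFst-suc zero    (suc m) _         = refl
pairSnd≡pairFst-suc (suc t) (suc m) (s≤s t<m) = cong suc (pairSnd≡pairFst-suc t m t<m)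

skipPair-mono-< : ∀ t {i j : Fin m} → i Fin.< j → skipPair t i Fin.< skipPair t j
skipPair-mono-< zero    i<j = s≤s (s≤s i<j)
skipPair-mono-< (suc t) {zero}  {suc j} _         = s≤s z≤n
skipPair-mono-< (suc t) {suc i} {suc j} (s≤s i<j) = s≤s (skipPair-mono-< t i<j)

skipPair-cancel-< : ∀ t {i j : Fin m} → skipPair t i Fin.< skipPair t j → i Fin.< j
skipPair-cancel-< zero    (s≤s (s≤s i<j)) = i<j
skipPair-cancel-< (suc t) {zero}  {zero}  ()
skipPair-cancel-< (suc t) {zero}  {suc j} _         = s≤s z≤n
skipPair-cancel-< (suc t) {suc i} {zero}  ()
skipPair-cancel-< (suc t) {suc i} {suc j} (s≤s i<j) = s≤s (skipPair-cancel-< t i<j)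

skipPair-injective : ∀ t {i j : Fin m} → skipPair t i ≡ skipPair t j → i ≡ j
skipPair-injective zero    refl = refl
skipPair-injective (suc t) {zero}  {zero}  _  = refl
skipPair-injective (suc t) {suc i} {suc j} eq = cong suc (skipPair-injective t (Fin.suc-injective eq))

skipPair-surjective : ∀ t (y : Fin (2 + m)) → y ≢ pairFst t m → y ≢ pairSnd t m →
  ∃[ j ] skipPair t j ≡ y
skipPair-surjective zero zero          y≢fst _ = ⊥-elim (y≢fst refl)
skipPair-surjective zero (suc zero)    _ y≢snd = ⊥-elim (y≢snd refl)
skipPair-surjective zero (suc (suc j)) _ _     = j , refl
skipPair-surjective {m = zero}  (suc t) zero       y≢fst _ = ⊥-elim (y≢fst refl)
skipPair-surjective {m = zero}  (suc t) (suc zero) _ y≢snd = ⊥-elim (y≢snd refl)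
skipPair-surjective {m = suc m} (suc t) zero       _ _     = zero , refl
skipPair-surjective {m = suc m} (suc t) (suc y) y≢fst y≢snd
  with j , eq ← skipPair-surjective t y (y≢fst ∘′ cong suc) (y≢snd ∘′ cong suc)
  = suc j , cong suc eq

EmptyFrom : ℕ → Subset m → Set
EmptyFrom zero    v       = v ≡ ∅
EmptyFrom (suc p) []      = ⊤
EmptyFrom (suc p) (x ∷ v) = EmptyFrom p v

insertPair-∅ : ∀ t → insertPair t (∅ {m}) false false ≡ ∅
insertPair-∅ {m = zero}  zero    = refl
insertPair-∅ {m = zero}  (suc t) = refl
insertPair-∅ {m = suc m} zero    = refl
insertPair-∅ {m = suc m} (suc t) = cong (false ∷_) (insertPair-∅ t)

insertPair-emptyFrom : ∀ p t (v : Subset m) → EmptyFrom p v → p ≤ t →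
  insertPair t v false false ≡ insertPair p v false false
insertPair-emptyFrom zero    t       v       refl _ = trans (insertPair-∅ t) (sym (insertPair-∅ 0))
insertPair-emptyFrom (suc p) (suc t) []      _    _ = refl
insertPair-emptyFrom (suc p) (suc t) (x ∷ v) v∅ (s≤s p≤t) = cong (x ∷_) (insertPair-emptyFrom p t v v∅ p≤t)

-- Coefficients on squarefree monomials

coeff-∷-≡ : ∀ d {v e : Vec ℕ n} Q → v ≡ e → coeff ((d , v) ∷ Q) e ≡ d ℤ.+ coeff Q e
coeff-∷-≡ d {v} {e} Q v≡e with ≡-dec ℕ._≟_ v e
... | yes _   = refl
... | no  v≢e = ⊥-elim (v≢e v≡e)

coeff-∷-≢ : ∀ d {v e : Vec ℕ n} Q → v ≢ e → coeff ((d , v) ∷ Q) e ≡ coeff Q e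
coeff-∷-≢ d {v} {e} Q v≢e with ≡-dec ℕ._≟_ v e
... | yes v≡e = ⊥-elim (v≢e v≡e)
... | no  _   = refl

coeff-++ : ∀ (P Q : Poly n) e → coeff (P ++ Q) e ≡ coeff P e ℤ.+ coeff Q e
coeff-++ []            Q e = sym (ℤ.+-identityˡ _)
coeff-++ ((d , v) ∷ P) Q e with ≡-dec ℕ._≟_ v e
... | yes _ = trans (cong (ℤ._+_ d) (coeff-++ P Q e)) (sym (ℤ.+-assoc d _ _))
... | no  _ = coeff-++ P Q e

mapTerms : ℤ → (Vec ℕ n → Vec ℕ n) → Poly n → Poly n
mapTerms c h = List.map (λ u → c ℤ.* proj₁ u , h (proj₂ u))

coeff-mapTerms-hit : ∀ c (h : Vec ℕ n → Vec ℕ n) {e e'} → h e' ≡ e →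
  (∀ {v} → h v ≡ e → v ≡ e') → ∀ Q → coeff (mapTerms c h Q) e ≡ c ℤ.* coeff Q e'
coeff-mapTerms-hit c h he'≡e h-inj [] = sym (ℤ.*-zeroʳ c)
coeff-mapTerms-hit c h {e} {e'} he'≡e h-inj ((d , v) ∷ Q) with ≡-dec ℕ._≟_ (h v) e
... | yes hv≡e = begin
  c ℤ.* d ℤ.+ coeff (mapTerms c h Q) e ≡⟨ cong (ℤ._+_ (c ℤ.* d)) (coeff-mapTerms-hit c h he'≡e h-inj Q) ⟩
  c ℤ.* d ℤ.+ c ℤ.* coeff Q e'         ≡⟨ ℤ.*-distribˡ-+ c d _ ⟨
  c ℤ.* (d ℤ.+ coeff Q e')             ≡⟨ cong (c ℤ.*_) (coeff-∷-≡ d Q (h-inj hv≡e)) ⟨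
  c ℤ.* coeff ((d , v) ∷ Q) e'         ∎
  where open ≡-Reasoning
... | no hv≢e = trans (coeff-mapTerms-hit c h he'≡e h-inj Q)
  (cong (c ℤ.*_) (sym (coeff-∷-≢ d {v = v} Q λ { refl → hv≢e he'≡e })))

coeff-mapTerms-miss : ∀ c (h : Vec ℕ n → Vec ℕ n) {e} → (∀ v → h v ≢ e) →
  ∀ Q → coeff (mapTerms c h Q) e ≡ 0ℤ
coeff-mapTerms-miss c h miss []            = refl
coeff-mapTerms-miss c h miss ((d , v) ∷ Q) =
  trans (coeff-∷-≢ (c ℤ.* d) (mapTerms c h Q) (miss v)) (coeff-mapTerms-miss c h miss Q)

monoExp-∅ : monoExp (∅ {n}) ≡ replicate n 0
monoExp-∅ {n} = map-replicate _ false n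

monoExp-injective : {A B : Subset n} → monoExp A ≡ monoExp B → A ≡ B
monoExp-injective {A = []}        {[]}        _  = refl
monoExp-injective {A = true ∷ A}  {true ∷ B}  eq = cong (true ∷_) (monoExp-injective (∷-injectiveʳ eq))
monoExp-injective {A = false ∷ A} {false ∷ B} eq = cong (false ∷_) (monoExp-injective (∷-injectiveʳ eq))
monoExp-injective {A = true ∷ A}  {false ∷ B} ()
monoExp-injective {A = false ∷ A} {true ∷ B}  ()

zipWith-+-zeros : (v : Vec ℕ n) → zipWith _+_ (replicate n 0) v ≡ v
zipWith-+-zeros v = trans (zipWith-replicate₁ _+_ 0 v) (map-id v)

unitVec+monoExp : ∀ (a : Fin n) S → lookup S a ≡ true →
  zipWith _+_ (unitVec a) (monoExp (S [ a ]≔ false)) ≡ monoExp S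
unitVec+monoExp zero    (true ∷ S) refl = cong (1 ∷_) (zipWith-+-zeros (monoExp S))
unitVec+monoExp (suc a) (x ∷ S)    a∈S  = cong (_ ∷_) (unitVec+monoExp a S a∈S)

unitVec+≡monoExp⇒ : ∀ (a : Fin n) v S → zipWith _+_ (unitVec a) v ≡ monoExp S →
  lookup S a ≡ true × v ≡ monoExp (S [ a ]≔ false)
unitVec+≡monoExp⇒ zero (v₀ ∷ v) (true ∷ S) eq with e₀ , e ← ∷-injective eq =
  refl , cong₂ _∷_ (ℕ.suc-injective e₀) (trans (sym (zipWith-+-zeros v)) e)
unitVec+≡monoExp⇒ zero (v₀ ∷ v) (false ∷ S) eq with () ← ∷-injectiveˡ eq
unitVec+≡monoExp⇒ (suc a) (v₀ ∷ v) (x ∷ S) eq with e₀ , e ← ∷-injective eq =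
  Product.map₂ (cong₂ _∷_ e₀) (unitVec+≡monoExp⇒ a v S e)

Coeffs : ℕ → Set
Coeffs n = Subset n → ℤ

coeffs : Poly n → Coeffs n
coeffs P S = coeff P (monoExp S)

rootCoeffs : List (Factor n) → Coeffs n
rootCoeffs r = coeffs (rootPoly r)

indicator : Subset n → Coeffs n
indicator A S with ≡-dec Bool._≟_ A S
... | yes _ = 1ℤ
... | no  _ = 0ℤ

indicator-≡ : {A S : Subset n} → A ≡ S → indicator A S ≡ 1ℤ
indicator-≡ {A = A} {S} A≡S with ≡-dec Bool._≟_ A S
... | yes _   = refl
... | no  A≢S = ⊥-elim (A≢S A≡S)

indicator-≢ : {A S : Subset n} → A ≢ S → indicator A S ≡ 0ℤ
indicator-≢ {A = A} {S} A≢S with ≡-dec Bool._≟_ A S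
... | yes A≡S = ⊥-elim (A≢S A≡S)
... | no  _   = refl

indicator-⇔ : {A S : Subset m} {B T : Subset n} → (A ≡ S → B ≡ T) → (B ≡ T → A ≡ S) →
  indicator A S ≡ indicator B T
indicator-⇔ {A = A} {S} A≡S⇒B≡T B≡T⇒A≡S with ≡-dec Bool._≟_ A S
... | yes A≡S = sym (indicator-≡ (A≡S⇒B≡T A≡S))
... | no  A≢S = sym (indicator-≢ (A≢S ∘′ B≡T⇒A≡S))

indicator-lookup-≢ : ∀ {A S : Subset n} i {x} → lookup A i ≡ x → lookup S i ≡ not x →
  indicator A S ≡ 0ℤ
indicator-lookup-≢ i A[i]≡x S[i]≡¬x =
  indicator-≢ (λ A≡S → not-¬ A[i]≡x (trans (cong (λ U → lookup U i) A≡S) S[i]≡¬x))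

record IsLinear (Ψ : Coeffs m → Coeffs n) : Set where
  field
    resp-≗ : ∀ {G H} → G ≗ H → Ψ G ≗ Ψ H
    linear : ∀ c G H → Ψ (λ T → c ℤ.* G T ℤ.+ H T) ≗ λ S → c ℤ.* Ψ G S ℤ.+ Ψ H S
    map-0  : Ψ (λ _ → 0ℤ) ≗ λ _ → 0ℤ

  scale : ∀ c G → Ψ (λ T → c ℤ.* G T) ≗ λ S → c ℤ.* Ψ G S
  scale c G S = begin
    Ψ (λ T → c ℤ.* G T) S            ≡⟨ resp-≗ (λ T → sym (ℤ.+-identityʳ (c ℤ.* G T))) S ⟩
    Ψ (λ T → c ℤ.* G T ℤ.+ 0ℤ) S     ≡⟨ linear c G (λ _ → 0ℤ) S ⟩
    c ℤ.* Ψ G S ℤ.+ Ψ (λ _ → 0ℤ) S   ≡⟨ cong (ℤ._+_ (c ℤ.* Ψ G S)) (map-0 S) ⟩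
    c ℤ.* Ψ G S ℤ.+ 0ℤ               ≡⟨ ℤ.+-identityʳ _ ⟩
    c ℤ.* Ψ G S                      ∎
    where open ≡-Reasoning

  linear′ : ∀ c G H → Ψ (λ T → G T ℤ.+ c ℤ.* H T) ≗ λ S → Ψ G S ℤ.+ c ℤ.* Ψ H S
  linear′ c G H S = trans (resp-≗ (λ T → ℤ.+-comm (G T) (c ℤ.* H T)) S)
                          (trans (linear c H G S) (ℤ.+-comm (c ℤ.* Ψ H S) (Ψ G S)))

open IsLinear

keepIf : Bool → ℤ → ℤ
keepIf b z = if b then z else 0ℤ

keepIf-comm : ∀ b c x → keepIf b (keepIf c x) ≡ keepIf c (keepIf b x)
keepIf-comm true  c     x = refl
keepIf-comm false true  x = refl
keepIf-comm false false x = refl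

restrict : (Subset n → Bool) → (Subset n → Subset m) → Coeffs m → Coeffs n
restrict β ρ G S = keepIf (β S) (G (ρ S))

restrict-isLinear : ∀ (β : Subset n → Bool) (ρ : Subset n → Subset m) → IsLinear (restrict β ρ)
restrict-isLinear β ρ = record
  { resp-≗ = λ G≗H S → cong (keepIf (β S)) (G≗H (ρ S))
  ; linear = λ c G H S → keepIf-linear (β S) c (G (ρ S)) (H (ρ S))
  ; map-0  = λ S → keepIf-0 (β S)
  }
  where
  keepIf-linear : ∀ b c x y → keepIf b (c ℤ.* x ℤ.+ y) ≡ c ℤ.* keepIf b x ℤ.+ keepIf b y
  keepIf-linear true  c x y = refl
  keepIf-linear false c x y = cong (ℤ._+ 0ℤ) (sym (ℤ.*-zeroʳ c))
  keepIf-0 : ∀ b → keepIf b 0ℤ ≡ 0ℤ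
  keepIf-0 true  = refl
  keepIf-0 false = refl

∘-isLinear : {Ψ : Coeffs m → Coeffs n} {Φ : Coeffs o → Coeffs m} →
  IsLinear Ψ → IsLinear Φ → IsLinear (λ G → Ψ (Φ G))
∘-isLinear {Ψ = Ψ} {Φ} lin-Ψ lin-Φ = record
  { resp-≗ = λ G≗H → resp-≗ lin-Ψ (resp-≗ lin-Φ G≗H)
  ; linear = λ c G H S → trans (resp-≗ lin-Ψ (linear lin-Φ c G H) S) (linear lin-Ψ c (Φ G) (Φ H) S)
  ; map-0  = λ S → trans (resp-≗ lin-Ψ (map-0 lin-Φ) S) (map-0 lin-Ψ S)
  }

-- coefficient of x_S in x_a · g, for squarefree S
mulVar : Fin n → Coeffs n → Coeffs n
mulVar a = restrict (λ S → lookup S a) (_[ a ]≔ false)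

mulVar-isLinear : (a : Fin n) → IsLinear (mulVar a)
mulVar-isLinear a = restrict-isLinear _ (_[ a ]≔ false)

sign : Bool → ℤ
sign s = if s then 1ℤ else -1ℤ

mulFactor : Factor n → Coeffs n → Coeffs n
mulFactor f G S = mulVar (fst f) G S ℤ.+ sign (symm f) ℤ.* mulVar (snd f) G S

mulFactor-isLinear : (f : Factor n) → IsLinear (mulFactor f)
mulFactor-isLinear f = record
  { resp-≗ = λ G≗H S → cong₂ (λ x y → x ℤ.+ s ℤ.* y) (resp-≗ X₁ G≗H S) (resp-≗ X₂ G≗H S)
  ; linear = λ c G H S → trans (cong₂ (λ x y → x ℤ.+ s ℤ.* y) (linear X₁ c G H S) (linear X₂ c G H S))
                                (rearrange c _ _ _ _ s)
  ; map-0  = λ S → trans (cong₂ (λ x y → x ℤ.+ s ℤ.* y) (map-0 X₁ S) (map-0 X₂ S))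
                          (trans (ℤ.+-identityˡ _) (ℤ.*-zeroʳ s))
  }
  where
  s = sign (symm f)
  X₁ = mulVar-isLinear (fst f)
  X₂ = mulVar-isLinear (snd f)
  rearrange : ∀ c x y x' y' s →
    (c ℤ.* x ℤ.+ y) ℤ.+ s ℤ.* (c ℤ.* x' ℤ.+ y') ≡ c ℤ.* (x ℤ.+ s ℤ.* x') ℤ.+ (y ℤ.+ s ℤ.* y')
  rearrange = solve-∀

coeffs-mulVarTerms : ∀ c (a : Fin n) Q S →
  coeffs (mapTerms c (zipWith _+_ (unitVec a)) Q) S ≡ c ℤ.* mulVar a (coeffs Q) S
coeffs-mulVarTerms c a Q S with lookup S a in a∈S
... | true  = coeff-mapTerms-hit c _ (unitVec+monoExp a S a∈S)
                (λ {v} eq → proj₂ (unitVec+≡monoExp⇒ a v S eq)) Q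
... | false = trans (coeff-mapTerms-miss c _ (λ v eq → not-¬ a∈S (proj₁ (unitVec+≡monoExp⇒ a v S eq))) Q)
                    (sym (ℤ.*-zeroʳ c))

-- rootPoly (f ∷ r) unfolds to P ++ (Q ++ []) below.
rootCoeffs-∷ : ∀ (f : Factor n) r → rootCoeffs (f ∷ r) ≗ mulFactor f (rootCoeffs r)
rootCoeffs-∷ f r S = begin
  coeff (P ++ (Q ++ [])) e         ≡⟨ coeff-++ P _ e ⟩
  coeff P e ℤ.+ coeff (Q ++ []) e  ≡⟨ cong (ℤ._+_ (coeff P e)) (trans (coeff-++ Q [] e) (ℤ.+-identityʳ _)) ⟩
  coeff P e ℤ.+ coeff Q e          ≡⟨ cong₂ ℤ._+_ (coeffs-mulVarTerms 1ℤ (fst f) (rootPoly r) S)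
                                                  (coeffs-mulVarTerms s (snd f) (rootPoly r) S) ⟩
  1ℤ ℤ.* X ℤ.+ s ℤ.* Y             ≡⟨ cong (ℤ._+ s ℤ.* Y) (ℤ.*-identityˡ X) ⟩
  X ℤ.+ s ℤ.* Y                    ∎
  where
  open ≡-Reasoning
  e = monoExp S
  s = sign (symm f)
  P = mapTerms 1ℤ (zipWith _+_ (unitVec (fst f))) (rootPoly r)
  Q = mapTerms s (zipWith _+_ (unitVec (snd f))) (rootPoly r)
  X = mulVar (fst f) (rootCoeffs r) S
  Y = mulVar (snd f) (rootCoeffs r) S

rootCoeffs-[] : rootCoeffs {n} [] ≗ indicator ∅
rootCoeffs-[] {n} S with ≡-dec Bool._≟_ ∅ S
... | yes refl = coeff-∷-≡ 1ℤ {v = replicate n 0} [] (sym monoExp-∅)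
... | no  ∅≢S  = coeff-∷-≢ 1ℤ {v = replicate n 0} [] (∅≢S ∘′ monoExp-injective ∘′ trans monoExp-∅)

-- coefficient of x_S in g viewed as a polynomial in 2 + m variables, the pair t, t + 1 being new
embed : ℕ → Coeffs m → Coeffs (2 + m)
embed {m} t = restrict (λ S → not (lookup S (pairFst t m) ∨ lookup S (pairSnd t m))) (removePair t)

embed-isLinear : ∀ t → IsLinear (embed {m} t)
embed-isLinear t = restrict-isLinear _ (removePair t)

mulVar-skipPair-embed : ∀ t (a : Fin m) G → mulVar (skipPair t a) (embed t G) ≗ embed t (mulVar a G)
mulVar-skipPair-embed {m} t a G S
  rewrite lookup∘update′ (skipPair≢pairFst t a ∘′ sym) S false
        | lookup∘update′ (skipPair≢pairSnd t a ∘′ sym) S false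
        | removePair-update t a S false
        | lookup-removePair t S a
  = keepIf-comm (lookup S (skipPair t a)) (not (lookup S (pairFst t m) ∨ lookup S (pairSnd t m)))
                (G (removePair t S [ a ]≔ false))

embed-indicator : ∀ t (v : Subset m) → embed t (indicator v) ≗ indicator (insertPair t v false false)
embed-indicator {m} t v S with lookup S (pairFst t m) in fst∈S | lookup S (pairSnd t m) in snd∈S
... | true  | _     = sym (indicator-lookup-≢ (pairFst t m) (lookup-insertPair-fst t v false false) fst∈S)
... | false | true  = sym (indicator-lookup-≢ (pairSnd t m) (lookup-insertPair-snd t v false false) snd∈S)
... | false | false = indicator-⇔
  (λ { refl → trans (cong₂ (insertPair t (removePair t S)) (sym fst∈S) (sym snd∈S))
                    (insertPair-removePair t S) })
  (λ { refl → sym (removePair-insertPair t v false false) })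

mulVar-indicator : ∀ p (v : Subset m) →
  mulVar (pairFst p m) (indicator (insertPair p v false false)) ≗ indicator (insertPair p v true false)
mulVar-indicator {m} p v S with lookup S (pairFst p m) in fst∈S
... | false = sym (indicator-lookup-≢ (pairFst p m) (lookup-insertPair-fst p v true false) fst∈S)
... | true  = indicator-⇔ cleared⇒ (λ { refl → sym (update-insertPair-fst p v true false false) })
  where
  S≡ : insertPair p (removePair p S) true (lookup S (pairSnd p m)) ≡ S
  S≡ = trans (cong (λ x → insertPair p (removePair p S) x (lookup S (pairSnd p m))) (sym fst∈S))
             (insertPair-removePair p S)
  cleared⇒ : insertPair p v false false ≡ S [ pairFst p m ]≔ false → insertPair p v true false ≡ S
  cleared⇒ eq
    with v≡ , _ , false≡ ← insertPair-injective p
           (trans eq (trans (cong (_[ pairFst p m ]≔ false) (sym S≡))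
                            (update-insertPair-fst p (removePair p S) true (lookup S (pairSnd p m)) false)))
    = trans (cong₂ (λ w y → insertPair p w true y) v≡ false≡) S≡

skipFactor : ℕ → Factor m → Factor (2 + m)
skipFactor t f = factor (skipPair t (fst f)) (skipPair t (snd f)) (skipPair-mono-< t (lt f)) (symm f)

rootCoeffs-map-skipFactor : ∀ t (R : List (Factor m)) →
  rootCoeffs (List.map (skipFactor t) R) ≗ embed t (rootCoeffs R)
rootCoeffs-map-skipFactor t [] S = begin
  rootCoeffs [] S                          ≡⟨ rootCoeffs-[] S ⟩
  indicator ∅ S                            ≡⟨ cong (λ A → indicator A S) (insertPair-∅ t) ⟨
  indicator (insertPair t ∅ false false) S ≡⟨ embed-indicator t ∅ S ⟨
  embed t (indicator ∅) S                  ≡⟨ resp-≗ (embed-isLinear t) rootCoeffs-[] S ⟨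
  embed t (rootCoeffs []) S                ∎
  where open ≡-Reasoning
rootCoeffs-map-skipFactor t (f ∷ R) S = begin
  rootCoeffs (skipFactor t f ∷ R′) S
    ≡⟨ rootCoeffs-∷ (skipFactor t f) R′ S ⟩
  mulFactor (skipFactor t f) (rootCoeffs R′) S
    ≡⟨ resp-≗ (mulFactor-isLinear (skipFactor t f)) (rootCoeffs-map-skipFactor t R) S ⟩
  mulVar (skipPair t (fst f)) (embed t G) S ℤ.+ s ℤ.* mulVar (skipPair t (snd f)) (embed t G) S
    ≡⟨ cong₂ (λ x y → x ℤ.+ s ℤ.* y) (mulVar-skipPair-embed t (fst f) G S)
                                     (mulVar-skipPair-embed t (snd f) G S) ⟩
  embed t (mulVar (fst f) G) S ℤ.+ s ℤ.* embed t (mulVar (snd f) G) S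
    ≡⟨ linear′ (embed-isLinear t) s (mulVar (fst f) G) (mulVar (snd f) G) S ⟨
  embed t (mulFactor f G) S
    ≡⟨ resp-≗ (embed-isLinear t) (rootCoeffs-∷ f R) S ⟨
  embed t (rootCoeffs (f ∷ R)) S ∎
  where
  open ≡-Reasoning
  R′ = List.map (skipFactor t) R
  s  = sign (symm f)
  G  = rootCoeffs R

-- Combinations of roots

Combination : ℕ → Set
Combination n = List (List (Factor n) × ℕ)

combValue : Combination n → Coeffs n
combValue []            S = 0ℤ
combValue ((r , c) ∷ L) S = + c ℤ.* rootCoeffs r S ℤ.+ combValue L S

combValue-++ : ∀ (L M : Combination n) → combValue (L ++ M) ≗ λ S → combValue L S ℤ.+ combValue M S
combValue-++ []            M S = sym (ℤ.+-identityˡ _)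
combValue-++ ((r , c) ∷ L) M S =
  trans (cong (ℤ._+_ (+ c ℤ.* rootCoeffs r S)) (combValue-++ L M S))
        (sym (ℤ.+-assoc (+ c ℤ.* rootCoeffs r S) _ _))

mapRoots : (List (Factor m) → List (Factor n)) → ℕ → Combination m → Combination n
mapRoots f d = List.map (Product.map f (d *_))

combValue-mapRoots : ∀ {Ψ : Coeffs m → Coeffs n} {f} → IsLinear Ψ →
  (∀ R → rootCoeffs (f R) ≗ Ψ (rootCoeffs R)) →
  ∀ d L → combValue (mapRoots f d L) ≗ λ S → + d ℤ.* Ψ (combValue L) S
combValue-mapRoots lin f-hom d []            S = sym (trans (cong (+ d ℤ.*_) (map-0 lin S)) (ℤ.*-zeroʳ (+ d)))
combValue-mapRoots {Ψ = Ψ} {f} lin f-hom d ((R , c) ∷ L) S = begin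
  + (d * c) ℤ.* rootCoeffs (f R) S ℤ.+ combValue (mapRoots f d L) S
    ≡⟨ cong₂ (λ x y → x ℤ.* y ℤ.+ combValue (mapRoots f d L) S) (ℤ.pos-* d c) (f-hom R S) ⟩
  + d ℤ.* + c ℤ.* Ψ (rootCoeffs R) S ℤ.+ combValue (mapRoots f d L) S
    ≡⟨ cong (ℤ._+_ (+ d ℤ.* + c ℤ.* Ψ (rootCoeffs R) S)) (combValue-mapRoots lin f-hom d L S) ⟩
  + d ℤ.* + c ℤ.* Ψ (rootCoeffs R) S ℤ.+ + d ℤ.* Ψ (combValue L) S
    ≡⟨ distrib (+ d) (+ c) _ _ ⟩
  + d ℤ.* (+ c ℤ.* Ψ (rootCoeffs R) S ℤ.+ Ψ (combValue L) S)
    ≡⟨ cong (+ d ℤ.*_) (linear lin (+ c) (rootCoeffs R) (combValue L) S) ⟨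
  + d ℤ.* Ψ (combValue ((R , c) ∷ L)) S ∎
  where
  open ≡-Reasoning
  distrib : ∀ d c x y → d ℤ.* c ℤ.* x ℤ.+ d ℤ.* y ≡ d ℤ.* (c ℤ.* x ℤ.+ y)
  distrib = solve-∀

newFactor : ℕ → Bool → Factor (2 + m)
newFactor {m} t s = factor (pairFst t m) (pairSnd t m) (pairFst<pairSnd t m) s

extendRoot : ℕ → Bool → List (Factor m) → List (Factor (2 + m))
extendRoot t s R = newFactor t s ∷ List.map (skipFactor t) R

rootCoeffs-extendRoot : ∀ t s (R : List (Factor m)) →
  rootCoeffs (extendRoot t s R) ≗ mulFactor (newFactor t s) (embed t (rootCoeffs R))
rootCoeffs-extendRoot t s R S = trans (rootCoeffs-∷ (newFactor t s) (List.map (skipFactor t) R) S)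
  (resp-≗ (mulFactor-isLinear (newFactor t s)) (rootCoeffs-map-skipFactor t R) S)

-- Iterates 2x_t = 2(x_t − x_{t+1}) + 2x_{t+1}, closing with 2x_t = (x_t − x_{t+1}) + (x_t + x_{t+1})
-- at the last pair.
telescope : Combination m → ℕ → ℕ → Combination (2 + m)
telescope L t zero    = mapRoots (extendRoot t false) 1 L ++ mapRoots (extendRoot t true) 1 L
telescope L t (suc j) = mapRoots (extendRoot t false) 2 L ++ telescope L (suc t) j

module _ (L : Combination m) (K : ℕ) (v : Subset m) (p : ℕ) (v∅ : EmptyFrom p v)
         (L≗Kv : combValue L ≗ λ S → + K ℤ.* indicator v S) where

  private
    v⁺ : Subset (2 + m)
    v⁺ = insertPair p v false false

  embed-combValue : ∀ {t} → p ≤ t → embed t (combValue L) ≗ λ S → + K ℤ.* indicator v⁺ S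
  embed-combValue {t} p≤t S = begin
    embed t (combValue L) S                          ≡⟨ resp-≗ (embed-isLinear t) L≗Kv S ⟩
    embed t (λ T → + K ℤ.* indicator v T) S          ≡⟨ scale (embed-isLinear t) (+ K) (indicator v) S ⟩
    + K ℤ.* embed t (indicator v) S                  ≡⟨ cong (+ K ℤ.*_) (embed-indicator t v S) ⟩
    + K ℤ.* indicator (insertPair t v false false) S ≡⟨ cong (λ A → + K ℤ.* indicator A S) v⁺-independent ⟩
    + K ℤ.* indicator v⁺ S                           ∎
    where
    open ≡-Reasoning
    v⁺-independent = insertPair-emptyFrom p t v v∅ p≤t

  combValue-extend : ∀ {t} s d → p ≤ t →
    combValue (mapRoots (extendRoot t s) d L) ≗ λ S → + d ℤ.* (+ K ℤ.* mulFactor (newFactor t s) (indicator v⁺) S)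
  combValue-extend {t} s d p≤t S =
    trans (combValue-mapRoots (∘-isLinear new-isLinear (embed-isLinear t)) (rootCoeffs-extendRoot t s) d L S)
          (cong (+ d ℤ.*_) (trans (resp-≗ new-isLinear (embed-combValue p≤t) S)
                                  (scale new-isLinear (+ K) (indicator v⁺) S)))
    where new-isLinear = mulFactor-isLinear (newFactor t s)

  combValue-telescope : ∀ t j → p ≤ t → t + j ≡ m →
    combValue (telescope L t j) ≗ λ S → + 2 ℤ.* + K ℤ.* mulVar (pairFst t m) (indicator v⁺) S
  combValue-telescope t zero p≤t _ S = begin
    combValue (telescope L t zero) S
      ≡⟨ combValue-++ (mapRoots (extendRoot t false) 1 L) _ S ⟩
    _ ≡⟨ cong₂ ℤ._+_ (combValue-extend false 1 p≤t S) (combValue-extend true 1 p≤t S) ⟩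
    + 1 ℤ.* (+ K ℤ.* (X ℤ.+ -1ℤ ℤ.* Y)) ℤ.+ + 1 ℤ.* (+ K ℤ.* (X ℤ.+ 1ℤ ℤ.* Y))
      ≡⟨ last-pair (+ K) X Y ⟩
    + 2 ℤ.* + K ℤ.* X ∎
    where
    open ≡-Reasoning
    X = mulVar (pairFst t m) (indicator v⁺) S
    Y = mulVar (pairSnd t m) (indicator v⁺) S
    last-pair : ∀ K x y →
      + 1 ℤ.* (K ℤ.* (x ℤ.+ -1ℤ ℤ.* y)) ℤ.+ + 1 ℤ.* (K ℤ.* (x ℤ.+ 1ℤ ℤ.* y)) ≡ + 2 ℤ.* K ℤ.* x
    last-pair = solve-∀
  combValue-telescope t (suc j) p≤t t+[1+j]≡m S = begin
    combValue (telescope L t (suc j)) S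
      ≡⟨ combValue-++ (mapRoots (extendRoot t false) 2 L) _ S ⟩
    _ ≡⟨ cong₂ ℤ._+_ (combValue-extend false 2 p≤t S)
                      (trans (combValue-telescope (suc t) j (ℕ.m≤n⇒m≤1+n p≤t) [1+t]+j≡m S)
                             (cong (+ 2 ℤ.* + K ℤ.*_) next≡snd)) ⟩
    + 2 ℤ.* (+ K ℤ.* (X ℤ.+ -1ℤ ℤ.* Y)) ℤ.+ + 2 ℤ.* + K ℤ.* Y
      ≡⟨ inner-pair (+ K) X Y ⟩
    + 2 ℤ.* + K ℤ.* X ∎
    where
    open ≡-Reasoning
    X = mulVar (pairFst t m) (indicator v⁺) S
    Y = mulVar (pairSnd t m) (indicator v⁺) S
    [1+t]+j≡m : suc t + j ≡ m
    [1+t]+j≡m = trans (sym (ℕ.+-suc t j)) t+[1+j]≡m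
    next≡snd : mulVar (pairFst (suc t) m) (indicator v⁺) S ≡ Y
    next≡snd = cong (λ i → mulVar i (indicator v⁺) S)
                    (sym (pairSnd≡pairFst-suc t m (subst (t <_) t+[1+j]≡m (ℕ.m<m+n t (s≤s z≤n)))))
    inner-pair : ∀ K x y →
      + 2 ℤ.* (K ℤ.* (x ℤ.+ -1ℤ ℤ.* y)) ℤ.+ + 2 ℤ.* K ℤ.* y ≡ + 2 ℤ.* K ℤ.* x
    inner-pair = solve-∀

  combValue-telescope-from : p ≤ m →
    combValue (telescope L p (m ∸ p)) ≗ λ S → + 2 ℤ.* + K ℤ.* indicator (insertPair p v true false) S
  combValue-telescope-from p≤m S =
    trans (combValue-telescope p (m ∸ p) ℕ.≤-refl (ℕ.m+[n∸m]≡n p≤m) S)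
          (cong (+ 2 ℤ.* + K ℤ.*_) (mulVar-indicator p v S))

-- Extending roots without defects

indices-map-skipFactor : ∀ t (R : List (Factor m)) →
  indices (List.map (skipFactor t) R) ≡ List.map (skipPair t) (indices R)
indices-map-skipFactor t []      = refl
indices-map-skipFactor t (f ∷ R) =
  cong (λ is → skipPair t (fst f) ∷ skipPair t (snd f) ∷ is) (indices-map-skipFactor t R)

module _ {m} (t : ℕ) (s : Bool) (R : List (Factor m)) where

  private
    R⁺ : List (Factor (2 + m))
    R⁺ = extendRoot t s R

    unskip : ∀ {i j : Fin m} → skipPair t i Fin.< skipPair t j → i Fin.< j
    unskip = skipPair-cancel-< t

  ∈-extendRoot : ∀ {f} → f ∈ R⁺ → f ≡ newFactor t s ⊎ ∃[ f₀ ] f₀ ∈ R × f ≡ skipFactor t f₀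
  ∈-extendRoot (here f≡new) = inj₁ f≡new
  ∈-extendRoot (there f∈)   = inj₂ (∈-map⁻ (skipFactor t) f∈)

  strictly-inside-pair : ∀ (y : Fin (2 + m)) → pairFst t m Fin.< y → y Fin.< pairSnd t m → ⊥
  strictly-inside-pair y fst<y y<snd =
    ℕ.<⇒≱ fst<y (ℕ.≤-pred (subst (suc (toℕ y) ≤_) (toℕ-pairSnd t m) y<snd))

  after-last-pair : m ≤ t → ∀ (y : Fin (2 + m)) → pairSnd t m Fin.< y → ⊥
  after-last-pair m≤t y snd<y =
    ℕ.<⇒≱ snd<y (subst (toℕ y ≤_) (sym (toℕ-pairSnd-last t m m≤t)) (Fin.toℕ≤pred[n] y))

  unused-extendRoot : ∀ j → Unused R⁺ (skipPair t j) → Unused R j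
  unused-extendRoot j unused j∈ =
    unused (there (there (subst (skipPair t j ∈_) (sym (indices-map-skipFactor t R)) (∈-map⁺ (skipPair t) j∈))))

  unused-extendRoot-skipPair : ∀ (y : Fin (2 + m)) → Unused R⁺ y → ∃[ j ] skipPair t j ≡ y
  unused-extendRoot-skipPair y unused = skipPair-surjective t y (unused ∘′ here) (unused ∘′ there ∘′ here)

  defect-extendRoot : (s ≡ true → m ≤ t) → Defect R⁺ → Defect R
  defect-extendRoot last (inj₁ (f , g , f∈ , g∈ , i<j , j<r , r<s))
    with ∈-extendRoot f∈ | ∈-extendRoot g∈
  ... | inj₁ refl | _         = ⊥-elim (strictly-inside-pair (fst g) i<j j<r)
  ... | inj₂ _    | inj₁ refl = ⊥-elim (strictly-inside-pair (snd f) j<r r<s)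
  ... | inj₂ (f₀ , f₀∈ , refl) | inj₂ (g₀ , g₀∈ , refl) =
    inj₁ (f₀ , g₀ , f₀∈ , g₀∈ , unskip i<j , unskip j<r , unskip r<s)
  defect-extendRoot last (inj₂ (inj₁ (f , g , f∈ , g∈ , g-symm , i<j , j<r , r<s)))
    with ∈-extendRoot f∈ | ∈-extendRoot g∈
  ... | _         | inj₁ refl = ⊥-elim (after-last-pair (last g-symm) (snd f) r<s)
  ... | inj₁ refl | inj₂ _    = ⊥-elim (strictly-inside-pair (fst g) i<j (ℕ.<-trans j<r r<s))
  ... | inj₂ (f₀ , f₀∈ , refl) | inj₂ (g₀ , g₀∈ , refl) =
    inj₂ (inj₁ (f₀ , g₀ , f₀∈ , g₀∈ , g-symm , unskip i<j , unskip j<r , unskip r<s))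
  defect-extendRoot last (inj₂ (inj₂ (inj₁ (f , y , f∈ , unused , i<y , y<r)))) with ∈-extendRoot f∈
  ... | inj₁ refl = ⊥-elim (strictly-inside-pair y i<y y<r)
  ... | inj₂ (f₀ , f₀∈ , refl) with j , refl ← unused-extendRoot-skipPair y unused =
    inj₂ (inj₂ (inj₁ (f₀ , j , f₀∈ , unused-extendRoot j unused , unskip i<y , unskip y<r)))
  defect-extendRoot last (inj₂ (inj₂ (inj₂ (f , y , f∈ , f-symm , unused , j<y)))) with ∈-extendRoot f∈
  ... | inj₁ refl = ⊥-elim (after-last-pair (last f-symm) y j<y)
  ... | inj₂ (f₀ , f₀∈ , refl) with j , refl ← unused-extendRoot-skipPair y unused =
    inj₂ (inj₂ (inj₂ (f₀ , j , f₀∈ , f-symm , unused-extendRoot j unused , unskip j<y)))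

  unique-extendRoot : Unique (indices R) → Unique (indices R⁺)
  unique-extendRoot unique =
    subst (λ is → Unique (pairFst t m ∷ pairSnd t m ∷ is)) (sym (indices-map-skipFactor t R))
    ( (fst≢snd ∷ avoids (skipPair≢pairFst t) (indices R))
    ∷ avoids (skipPair≢pairSnd t) (indices R)
    ∷ Unique.map⁺ (skipPair-injective t) unique)
    where
    fst≢snd : pairFst t m ≢ pairSnd t m
    fst≢snd eq = ℕ.<-irrefl (cong toℕ eq) (pairFst<pairSnd t m)
    avoids : ∀ {z} → (∀ j → skipPair t j ≢ z) → ∀ is → All (z ≢_) (List.map (skipPair t) is)
    avoids skip≢z is = All.map⁺ (All.universal (λ j → skip≢z j ∘′ sym) is)

  inB-extendRoot : ∀ {k} → InB k R → (s ≡ true → m ≤ t) → InB (suc k) R⁺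
  inB-extendRoot ((|R|≡k , unique) , no-defect) last =
    (cong suc (trans (List.length-map (skipFactor t) R) |R|≡k) , unique-extendRoot unique) ,
    no-defect ∘′ defect-extendRoot last

-- Reverse lattice words

word : Subset n → List ℕ
word I = toList (label I)

ReverseLattice : Subset n → Set
ReverseLattice I = ReverseLatticeWord (word I)

-- The label of I ends in 2 1 1 … 1, with its last 2 at position p.
data EndsWith21 : Subset n → Set where
  endsWith21 : ∀ {m} p (I₀ : Subset m) → p ≤ m → EmptyFrom p I₀ →
               EndsWith21 (insertPair p I₀ true false)

∅-or-endsWith21 : ∀ (I : Subset n) → ReverseLattice I → I ≡ ∅ ⊎ EndsWith21 I
∅-or-endsWith21 []      _        = inj₁ refl
∅-or-endsWith21 (x ∷ I) (rl , _) with ∅-or-endsWith21 I rl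
... | inj₂ (endsWith21 p I₀ p≤m I₀∅) = inj₂ (endsWith21 (suc p) (x ∷ I₀) (s≤s p≤m) I₀∅)
∅-or-endsWith21               (false ∷ _) _        | inj₁ refl = inj₁ refl
∅-or-endsWith21 {suc zero}    (true ∷ _)  (_ , ()) | inj₁ refl
∅-or-endsWith21 {suc (suc m)} (true ∷ _)  _        | inj₁ refl = inj₂ (endsWith21 0 ∅ z≤n refl)

count-2-insert21 : ∀ p (v : Subset m) → count 2 (word (insertPair p v true false)) ≡ suc (count 2 (word v))
count-2-insert21 zero    v           = refl
count-2-insert21 (suc p) []          = refl
count-2-insert21 (suc p) (true ∷ v)  = cong suc (count-2-insert21 p v)
count-2-insert21 (suc p) (false ∷ v) = count-2-insert21 p v

count-1-insert21 : ∀ p (v : Subset m) → count 1 (word (insertPair p v true false)) ≡ suc (count 1 (word v))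
count-1-insert21 zero    v           = refl
count-1-insert21 (suc p) []          = refl
count-1-insert21 (suc p) (true ∷ v)  = count-1-insert21 p v
count-1-insert21 (suc p) (false ∷ v) = cong suc (count-1-insert21 p v)

reverseLattice-insert21⁻ : ∀ p (v : Subset m) → ReverseLattice (insertPair p v true false) → ReverseLattice v
reverseLattice-insert21⁻ zero    v           ((rl , _) , _) = rl
reverseLattice-insert21⁻ (suc p) []          _              = _
reverseLattice-insert21⁻ (suc p) (true ∷ v)  (rl , #2≤#1)   = reverseLattice-insert21⁻ p v rl ,
  ℕ.≤-pred (subst₂ (λ a b → suc a ≤ b) (count-2-insert21 p v) (count-1-insert21 p v) #2≤#1)
reverseLattice-insert21⁻ (suc p) (false ∷ v) (rl , #2≤#1)   = reverseLattice-insert21⁻ p v rl ,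
  ℕ.≤-pred (subst₂ (λ a b → a ≤ suc b) (count-2-insert21 p v) (count-1-insert21 p v) #2≤#1)

∣insert21∣ : ∀ p (v : Subset m) → ∣ insertPair p v true false ∣ ≡ suc ∣ v ∣
∣insert21∣ zero    v           = refl
∣insert21∣ (suc p) []          = refl
∣insert21∣ (suc p) (true ∷ v)  = cong suc (∣insert21∣ p v)
∣insert21∣ (suc p) (false ∷ v) = ∣insert21∣ p v

inB-[] : InB {n} 0 []
inB-[] = (refl , []) , λ
  { (inj₁ (_ , _ , () , _))
  ; (inj₂ (inj₁ (_ , _ , () , _)))
  ; (inj₂ (inj₂ (inj₁ (_ , _ , () , _))))
  ; (inj₂ (inj₂ (inj₂ (_ , _ , () , _))))
  }

AllInB : ℕ → Combination n → Set
AllInB k = All (λ q → InB k (proj₁ q))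

allInB-mapRoots : ∀ {k} t s d (L : Combination m) → (s ≡ true → m ≤ t) →
  AllInB k L → AllInB (suc k) (mapRoots (extendRoot t s) d L)
allInB-mapRoots t s d L last L∈B = All.map⁺ (All.map (λ R∈B → inB-extendRoot t s _ R∈B last) L∈B)

allInB-telescope : ∀ {k} (L : Combination m) → AllInB k L →
  ∀ t j → t + j ≡ m → AllInB (suc k) (telescope L t j)
allInB-telescope L L∈B t zero    t+0≡m = All.++⁺
  (allInB-mapRoots t false 1 L (λ ()) L∈B)
  (allInB-mapRoots t true  1 L (λ _ → ℕ.≤-reflexive (trans (sym t+0≡m) (ℕ.+-identityʳ t))) L∈B)
allInB-telescope L L∈B t (suc j) t+[1+j]≡m = All.++⁺
  (allInB-mapRoots t false 2 L (λ ()) L∈B)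
  (allInB-telescope L L∈B (suc t) j (trans (sym (ℕ.+-suc t j)) t+[1+j]≡m))

Expansion : ℕ → Subset n → Set
Expansion {n} k I = ∃[ L ] AllInB k L × (combValue L ≗ λ S → + (2 ^ k) ℤ.* indicator I S)

expansion : ∀ k (I : Subset n) → ∣ I ∣ ≡ k → ReverseLattice I → Expansion k I
expansion k I ∣I∣≡k rl with ∅-or-endsWith21 I rl
expansion zero    _ _ _ | inj₁ refl =
  (([] , 1) ∷ []) , inB-[] ∷ All.[] , λ S → trans (ℤ.+-identityʳ _) (cong (+ 1 ℤ.*_) (rootCoeffs-[] S))
expansion {n} (suc k) _ ∣∅∣≡1+k _ | inj₁ refl =
  ⊥-elim (ℕ.0≢1+n (trans (sym (∣⊥∣≡0 n)) ∣∅∣≡1+k))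
expansion zero _ ∣I∣≡0 _ | inj₂ (endsWith21 p I₀ _ _) =
  ⊥-elim (ℕ.1+n≢0 (trans (sym (∣insert21∣ p I₀)) ∣I∣≡0))
expansion (suc k) _ ∣I∣≡1+k rl | inj₂ (endsWith21 {m} p I₀ p≤m I₀∅)
  with L₀ , L₀∈B , L₀≗ ← expansion k I₀ (ℕ.suc-injective (trans (sym (∣insert21∣ p I₀)) ∣I∣≡1+k))
                                       (reverseLattice-insert21⁻ p I₀ rl)
  = telescope L₀ p (m ∸ p) ,
    allInB-telescope L₀ L₀∈B p (m ∸ p) (ℕ.m+[n∸m]≡n p≤m) ,
    λ S → trans (combValue-telescope-from L₀ (2 ^ k) I₀ p I₀∅ L₀≗ p≤m S)
                (cong (ℤ._* indicator (insertPair p I₀ true false) S) (sym (ℤ.pos-* 2 (2 ^ k))))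

-- Rescaling to rational coefficients

toℚᵘ-/ : ∀ a D .{{_ : ℕ.NonZero D}} → ℚ.toℚᵘ (a ℚ./ D) ≃ᵘ a ℚᵘ./ D
toℚᵘ-/ a (suc d) = ℚ.toℚᵘ-fromℚᵘ (mkℚᵘ a d)

[c/D]*[z/1]+[w/D]≡[c*z+w]/D : ∀ c z w D .{{_ : ℕ.NonZero D}} →
  (c ℚ./ D) ℚ.* (z ℚ./ 1) ℚ.+ (w ℚ./ D) ≡ (c ℤ.* z ℤ.+ w) ℚ./ D
[c/D]*[z/1]+[w/D]≡[c*z+w]/D c z w D@(suc d) = ℚ.toℚᵘ-injective (begin
  ℚ.toℚᵘ ((c ℚ./ D) ℚ.* (z ℚ./ 1) ℚ.+ (w ℚ./ D))
    ≈⟨ ℚ.toℚᵘ-homo-+ ((c ℚ./ D) ℚ.* (z ℚ./ 1)) (w ℚ./ D) ⟩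
  ℚ.toℚᵘ ((c ℚ./ D) ℚ.* (z ℚ./ 1)) ℚᵘ.+ ℚ.toℚᵘ (w ℚ./ D)
    ≈⟨ ℚᵘ.+-cong (ℚᵘ.≃-trans (ℚ.toℚᵘ-homo-* (c ℚ./ D) (z ℚ./ 1)) (ℚᵘ.*-cong (toℚᵘ-/ c D) (toℚᵘ-/ z 1)))
                 (toℚᵘ-/ w D) ⟩
  (c ℚᵘ./ D) ℚᵘ.* (z ℚᵘ./ 1) ℚᵘ.+ (w ℚᵘ./ D)
    ≈⟨ *≡* (cross-multiplied c z w d) ⟩
  (c ℤ.* z ℤ.+ w) ℚᵘ./ D
    ≈⟨ ℚᵘ.≃-sym (toℚᵘ-/ (c ℤ.* z ℤ.+ w) D) ⟩
  ℚ.toℚᵘ ((c ℤ.* z ℤ.+ w) ℚ./ D) ∎)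
  where
  open ℚᵘ.≃-Reasoning
  cross-multiplied : ∀ c z w d → (c ℤ.* z ℤ.* + suc d ℤ.+ w ℤ.* + suc (d * 1)) ℤ.* + suc d
                                 ≡ (c ℤ.* z ℤ.+ w) ℤ.* + (suc (d * 1) * suc d)
  cross-multiplied c z w d rewrite ℕ.*-identityʳ d | ℤ.pos-* (suc d) (suc d) = ring c z w (+ suc d)
    where
    ring : ∀ c z w D → (c ℤ.* z ℤ.* D ℤ.+ w ℤ.* D) ℤ.* D ≡ (c ℤ.* z ℤ.+ w) ℤ.* (D ℤ.* D)
    ring = solve-∀

[D*z]/D≡z/1 : ∀ z D .{{_ : ℕ.NonZero D}} → (+ D ℤ.* z) ℚ./ D ≡ z ℚ./ 1
[D*z]/D≡z/1 z D@(suc d) = ℚ.toℚᵘ-injective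
  (ℚᵘ.≃-trans (toℚᵘ-/ (+ D ℤ.* z) D)
              (ℚᵘ.≃-trans (*≡* (cancel (+ D) z)) (ℚᵘ.≃-sym (toℚᵘ-/ z 1))))
  where
  cancel : ∀ D z → (D ℤ.* z) ℤ.* + 1 ≡ z ℤ.* D
  cancel = solve-∀

rescale : (D : ℕ) .{{_ : ℕ.NonZero D}} → Combination n → List (List (Factor n) × ℚ)
rescale D = List.map (Product.map₂ (λ c → + c ℚ./ D))

combCoeff-rescale : ∀ D .{{_ : ℕ.NonZero D}} (L : Combination n) S →
  combCoeff (rescale D L) S ≡ combValue L S ℚ./ D
combCoeff-rescale D []            S = sym (ℚ.0/n≡0 D)
combCoeff-rescale D ((r , c) ∷ L) S =
  trans (cong (λ q → (+ c ℚ./ D) ℚ.* ℤtoℚ (rootCoeffs r S) ℚ.+ q) (combCoeff-rescale D L S))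
        ([c/D]*[z/1]+[w/D]≡[c*z+w]/D (+ c) (rootCoeffs r S) (combValue L S) D)

monoCoeff-indicator : ∀ (I S : Subset n) → monoCoeff I S ≡ indicator I S ℚ./ 1
monoCoeff-indicator I S with ≡-dec Bool._≟_ I S
... | yes _ = refl
... | no  _ = refl

theorem4p8 : (n k : ℕ) → 2 ≤ n → 2 * k ≤ n → (I : Subset n) → ∣ I ∣ ≡ k →
    ReverseLatticeWord (toList (label I)) →
    ∃[ L ] All (λ p → InB k (proj₁ p) × IsMultOfInvPow2 k (proj₂ p)) L ×
      ((S : Subset n) → ∣ S ∣ ≡ k → monoCoeff I S ≡ combCoeff {n} L S)
theorem4p8 n k _ _ I ∣I∣≡k rl with L , L∈B , L≗ ← expansion k I ∣I∣≡k rl =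
  rescale D L , All.map⁺ (All.map (λ {q} R∈B → R∈B , proj₂ q , refl) L∈B) , λ S _ → begin
    monoCoeff I S                      ≡⟨ monoCoeff-indicator I S ⟩
    indicator I S ℚ./ 1                ≡⟨ [D*z]/D≡z/1 (indicator I S) D ⟨
    (+ D ℤ.* indicator I S) ℚ./ D      ≡⟨ cong (ℚ._/ D) (L≗ S) ⟨
    combValue L S ℚ./ D                ≡⟨ combCoeff-rescale D L S ⟨
    combCoeff (rescale D L) S          ∎
  where
  open ≡-Reasoning
  D = 2 ^ k
  instance _ = ℕ.m^n≢0 2 k
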